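{- For $n\geq 2$, $a_n(321;213) = 2^{n-2}$.
   Context: $\mathcal{S}_n$ is the set of permutations of $[n]=\{1,\dots,n\}$, written in one-line notation $\pi=\pi_1\pi_2\cdots\pi_n$ with $\pi_i=\pi(i)$. A permutation is cyclic if it consists of exactly one $n$-cycle. For a cyclic $\pi$, its standard cycle notation is $C(\pi)=(c_1,c_2,\dots,c_n)$ with $c_1=1$ and $c_i=\pi_{c_{i-1}}$ for $2\le i\le n$. A sequence of distinct integers $w_1\cdots w_m$ contains a pattern $\sigma\in\mathcal{S}_k$ if there are indices $i_1<\dots<i_k$ with $w_{i_1}\cdots w_{i_k}$ in the same relative order as $\sigma_1\cdots\sigma_k$; otherwise it avoids $\sigma$. For $\sigma,\tau\in\mathcal{S}_3$, $\mathcal{A}_n(\sigma;\tau)$ is the set of cyclic permutations $\pi\in\mathcal{S}_n$ whose one-line notation avoids $\sigma$ and whose cycle notation $C(\pi)$ (as the sequence $c_1c_2\cdots c_n$) avoids $\tau$; $a_n(\sigma;\tau)=|\mathcal{A}_n(\sigma;\tau)|$. -}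

module Defs where

open import Data.Nat using (ℕ; zero; suc; _<_)
open import Data.Fin using (Fin; toℕ) renaming (_<_ to _<ᶠ_)
open import Data.Vec using (Vec; lookup; tabulate)
open import Data.Product using (Σ; ∃; _×_; _,_)
open import Function.Bundles using (_⇔_)
open import Function.Definitions using (Injective)
open import Relation.Binary.PropositionalEquality using (_≡_)
open import Relation.Nullary using (¬_)

-- A permutation of [n] is given by its one-line notation: a vector
-- v = π₁ … πₙ (entries in Fin n, i.e. 0-based values) that is injective
-- (hence bijective, as the set is finite).
IsPermutation : {n : ℕ} → Vec (Fin n) n → Set
IsPermutation v = Injective _≡_ _≡_ (lookup v)

iter : {A : Set} → (A → A) → ℕ → A → A
iter f zero    a = a
iter f (suc k) a = f (iter f k a)

-- Cycle notation sequence starting at the smallest element 1 (index 0):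
-- c_1 = 1, c_i = π(c_{i-1}); as a 0-based sequence c_i = π^i(0).
cycleSeq : {n : ℕ} → Vec (Fin (suc n)) (suc n) → Vec (Fin (suc n)) (suc n)
cycleSeq v = tabulate (λ i → iter (lookup v) (toℕ i) Data.Fin.zero)

-- π is cyclic (a single n-cycle): the orbit of 1 under π is all of [n].
-- (For a permutation this is equivalent to having exactly one cycle.)
IsCyclic : {n : ℕ} → Vec (Fin (suc n)) (suc n) → Set
IsCyclic {n} v = ∀ (j : Fin (suc n)) → ∃ λ (k : ℕ) → iter (lookup v) k Data.Fin.zero ≡ j

Contains : {m k : ℕ} → Vec (Fin m) m → Vec (Fin k) k → Set
Contains {m} {k} w σ =
  Σ (Fin k → Fin m) λ idx →
    (∀ a b → a <ᶠ b → idx a <ᶠ idx b) ×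
    (∀ a b → (lookup w (idx a) <ᶠ lookup w (idx b)) ⇔ (lookup σ a <ᶠ lookup σ b))

Avoids : {m k : ℕ} → Vec (Fin m) m → Vec (Fin k) k → Set
Avoids w σ = ¬ Contains w σ

open import Data.Vec using ([]; _∷_)
open import Data.Fin using (zero; suc)

p321 : Vec (Fin 3) 3
p321 = suc (suc zero) ∷ suc zero ∷ zero ∷ []

p213 : Vec (Fin 3) 3
p213 = suc zero ∷ zero ∷ suc (suc zero) ∷ []

InA321-213 : {n : ℕ} → Vec (Fin (suc n)) (suc n) → Set
InA321-213 v = IsPermutation v × IsCyclic v × Avoids v p321 × Avoids (cycleSeq v) p213

-- In 1-based terms: let π ∈ 𝒜_n(321;213) with n ≥ 3. In the cycle of π the
-- point 2 comes either right after 1 or last. Otherwise the cycle reads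
-- (1, a, …, 2, b, …); if a < b then a 2 b is a 213 in the cycle, and if b < a
-- then a b 2 = π(1) π(2) π(x), where π(x) = 2 and x > 2, is a 321 in π.
-- Deleting 1 from the cycle in the first case, and 2 in the second, and
-- standardising gives a member of 𝒜_{n-1}(321;213); conversely both
-- reinsertions preserve the two avoidance conditions. The two kinds are
-- disjoint, so a_n = 2 a_{n-1}, and a_2 = 1.
module Submission where

open import Defs
open import Data.Nat using (ℕ; zero; suc; _+_; _*_; _∸_; _^_; _≤_; _<_; z≤n; s≤s; z<s; s<s)
open import Data.Nat.Properties
  using (≤-refl; ≤-trans; ≤-antisym; <⇒≤; <⇒≱; ≰⇒>; 1+n≰n; n≮0; n<1+n; ≤-pred; m≤n⇒m≤1+n;
         m≤n⇒m<n∨m≡n; m∸n≤m; 1+n≢n; <-trans; m<n⇒0<n∸m; m+[n∸m]≡n; <-cmp; +-identityʳ)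
open import Data.Fin using (Fin; zero; suc; toℕ; fromℕ; fromℕ<; punchIn; punchOut)
  renaming (_<_ to _<ᶠ_)
import Data.Fin.Properties as Finₚ
open Finₚ
  using (toℕ<n; toℕ-fromℕ<; punchIn-injective; punchInᵢ≢i; punchIn-mono-≤; punchIn-cancel-≤;
         punchIn-punchOut)
open import Data.Vec using (Vec; []; _∷_; lookup; tabulate; map)
open import Data.Vec.Properties using (lookup∘tabulate; tabulate∘lookup; tabulate-cong; lookup-map)
open import Data.List using (List; []; _∷_; length; _++_) renaming (map to mapₗ)
open import Data.List.Properties using (length-++; length-map)
open import Data.List.Membership.Propositional using (_∈_)
open import Data.List.Membership.Propositional.Properties using (∈-map⁺; ∈-map⁻; ∈-++⁺ˡ; ∈-++⁺ʳ; ∈-++⁻)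
open import Data.List.Relation.Unary.Any using (here)
open import Data.List.Relation.Unary.Unique.Propositional using (Unique)
import Data.List.Relation.Unary.Unique.Propositional.Properties as Unique
open import Data.List.Relation.Unary.AllPairs using ([]; _∷_)
open import Data.List.Relation.Unary.All using ([])
open import Data.Product using (∃; _×_; _,_; proj₁; proj₂)
open import Data.Sum using (_⊎_; inj₁; inj₂; [_,_])
import Data.Sum as Sum
open import Data.Empty using (⊥-elim)
open import Function using (_∘_)
open import Function.Bundles using (_⇔_; mk⇔; Equivalence)
open import Function.Definitions using (Injective)
open import Relation.Binary.Definitions using (Tri; tri<; tri≈; tri>)
open import Relation.Binary.PropositionalEquality
  using (_≡_; _≢_; refl; sym; trans; cong; cong₂; subst; subst₂; module ≡-Reasoning)
open import Relation.Nullary using (¬_; Dec; yes; no)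
open import Relation.Nullary.Decidable using (True; toWitness; _→-dec_)

open Equivalence using (to; from)

iter-+ : ∀ {A : Set} (f : A → A) m n x → iter f (m + n) x ≡ iter f m (iter f n x)
iter-+ f zero    n x = refl
iter-+ f (suc m) n x = cong f (iter-+ f m n x)

iter-sucʳ : ∀ {A : Set} (f : A → A) k x → iter f (suc k) x ≡ iter f k (f x)
iter-sucʳ f zero    x = refl
iter-sucʳ f (suc k) x = cong f (iter-sucʳ f k x)

iter-injective : ∀ {A : Set} {f : A → A} → Injective _≡_ _≡_ f →
                 ∀ k {x y} → iter f k x ≡ iter f k y → x ≡ y
iter-injective inj zero    e = e
iter-injective inj (suc k) e = iter-injective inj k (inj e)

iter-closed : ∀ {A : Set} {f : A → A} (S : A → Set) → (∀ {x} → S x → S (f x)) →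
              ∀ k {x} → S x → S (iter f k x)
iter-closed S step zero    s = s
iter-closed S step (suc k) s = step (iter-closed S step k s)

iter-intertwine : ∀ {A B : Set} {f : A → A} {g : B → B} {σ : B → A} {z : B} →
                  (∀ x → g x ≢ z → f (σ x) ≡ σ (g x)) →
                  ∀ k {a} → (∀ j → 0 < j → j ≤ k → iter g j a ≢ z) →
                  iter f k (σ a) ≡ σ (iter g k a)
iter-intertwine comm zero    avoid = refl
iter-intertwine {f = f} comm (suc k) avoid =
  trans (cong f (iter-intertwine comm k (λ j 0<j j≤k → avoid j 0<j (m≤n⇒m≤1+n j≤k))))
        (comm _ (avoid (suc k) z<s ≤-refl))

orbit : ∀ {m} → Vec (Fin (suc m)) (suc m) → ℕ → Fin (suc m)
orbit v k = iter (lookup v) k zero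

lookup-cycleSeq : ∀ {m} (v : Vec (Fin (suc m)) (suc m)) i → lookup (cycleSeq v) i ≡ orbit v (toℕ i)
lookup-cycleSeq v = lookup∘tabulate (λ i → orbit v (toℕ i))

orbit-fixed : ∀ {m} (v : Vec (Fin (suc m)) (suc m)) → lookup v zero ≡ zero → ∀ k → orbit v k ≡ zero
orbit-fixed v v₀≡0 k = iter-closed (_≡ zero) (λ e → trans (cong (lookup v) e) v₀≡0) k refl

orbit-periodic : ∀ {m p} (v : Vec (Fin (suc m)) (suc m)) → 0 < p → orbit v p ≡ zero →
                 ∀ k → ∃ λ r → r < p × orbit v k ≡ orbit v r
orbit-periodic v 0<p ret zero = 0 , 0<p , refl
orbit-periodic {p = p} v 0<p ret (suc k) with orbit-periodic v 0<p ret k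
... | r , r<p , e with m≤n⇒m<n∨m≡n r<p
...   | inj₁ 1+r<p = suc r , 1+r<p , cong (lookup v) e
...   | inj₂ 1+r≡p = 0 , 0<p , (begin
        orbit v (suc k) ≡⟨ cong (lookup v) e ⟩
        orbit v (suc r) ≡⟨ cong (orbit v) 1+r≡p ⟩
        orbit v p       ≡⟨ ret ⟩
        zero            ∎)
  where open ≡-Reasoning

cyclic⇒reached-before : ∀ {m p} (v : Vec (Fin (suc m)) (suc m)) → IsCyclic v → 0 < p →
                        orbit v p ≡ zero → ∀ y → ∃ λ r → r < p × orbit v r ≡ y
cyclic⇒reached-before v cyc 0<p ret y with cyc y
... | k , e with orbit-periodic v 0<p ret k
...   | r , r<p , e′ = r , r<p , trans (sym e′) e

covered⇒≤ : ∀ {n p} (h : ℕ → Fin n) → (∀ y → ∃ λ r → r < p × h r ≡ y) → n ≤ p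
covered⇒≤ {n} {p} h cover = Finₚ.injective⇒≤ {f = time} time-injective
  where
  time : Fin n → Fin p
  time y = fromℕ< (proj₁ (proj₂ (cover y)))
  time-injective : Injective _≡_ _≡_ time
  time-injective {x} {y} e = begin
    x                   ≡⟨ sym (proj₂ (proj₂ (cover x))) ⟩
    h (proj₁ (cover x)) ≡⟨ cong h (Finₚ.fromℕ<-injective _ _ _ _ e) ⟩
    h (proj₁ (cover y)) ≡⟨ proj₂ (proj₂ (cover y)) ⟩
    y                   ∎
    where open ≡-Reasoning

cyclic⇒return-time≥ : ∀ {m p} (v : Vec (Fin (suc m)) (suc m)) → IsCyclic v → 0 < p →
                      orbit v p ≡ zero → suc m ≤ p
cyclic⇒return-time≥ v cyc 0<p ret = covered⇒≤ (orbit v) (cyclic⇒reached-before v cyc 0<p ret)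

cyclic⇒orbit≢0 : ∀ {m j} (v : Vec (Fin (suc m)) (suc m)) → IsCyclic v → 0 < j → j ≤ m →
                 orbit v j ≢ zero
cyclic⇒orbit≢0 v cyc 0<j j≤m ret = <⇒≱ (s≤s j≤m) (cyclic⇒return-time≥ v cyc 0<j ret)

cyclic⇒lookup0≢0 : ∀ {m} (v : Vec (Fin (suc (suc m))) (suc (suc m))) → IsCyclic v →
                   lookup v zero ≢ zero
cyclic⇒lookup0≢0 v cyc v₀≡0 with cyc (suc zero)
... | k , e = Finₚ.0≢1+n (trans (sym (orbit-fixed v v₀≡0 k)) e)

orbit-cancel : ∀ {m i j} (v : Vec (Fin (suc m)) (suc m)) → IsPermutation v → i ≤ j →
               orbit v i ≡ orbit v j → orbit v (j ∸ i) ≡ zero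
orbit-cancel {i = i} {j} v inj i≤j e = sym (iter-injective inj i (begin
  orbit v i                          ≡⟨ e ⟩
  orbit v j                          ≡⟨ cong (orbit v) (sym (m+[n∸m]≡n i≤j)) ⟩
  orbit v (i + (j ∸ i))              ≡⟨ iter-+ (lookup v) i (j ∸ i) zero ⟩
  iter (lookup v) i (orbit v (j ∸ i)) ∎))
  where open ≡-Reasoning

orbit-return : ∀ {m} (v : Vec (Fin (suc m)) (suc m)) → IsPermutation v → IsCyclic v →
               orbit v (suc m) ≡ zero
orbit-return {m} v inj cyc with Finₚ.pigeonhole (n<1+n (suc m)) (λ i → orbit v (toℕ i))
... | i , j , i<j , e = subst (λ d → orbit v d ≡ zero) d≡1+m ret
  where
  ret : orbit v (toℕ j ∸ toℕ i) ≡ zero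
  ret = orbit-cancel v inj (<⇒≤ i<j) e
  d≡1+m : toℕ j ∸ toℕ i ≡ suc m
  d≡1+m = ≤-antisym (≤-trans (m∸n≤m (toℕ j) (toℕ i)) (≤-pred (toℕ<n j)))
                    (cyclic⇒return-time≥ v cyc (m<n⇒0<n∸m i<j) ret)

cyclic⇒reached-early : ∀ {m} (v : Vec (Fin (suc m)) (suc m)) → IsPermutation v → IsCyclic v →
                       ∀ y → ∃ λ r → r < suc m × orbit v r ≡ y
cyclic⇒reached-early v inj cyc = cyclic⇒reached-before v cyc z<s (orbit-return v inj cyc)

orbit-collision : ∀ {m i j} (v : Vec (Fin (suc m)) (suc m)) → IsPermutation v → IsCyclic v →
                  i < j → j < suc m → orbit v i ≢ orbit v j
orbit-collision {i = i} {j} v inj cyc i<j j<n e =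
  cyclic⇒orbit≢0 v cyc (m<n⇒0<n∸m i<j) (≤-trans (m∸n≤m j i) (≤-pred j<n))
    (orbit-cancel v inj (<⇒≤ i<j) e)

orbit-injective : ∀ {m i j} (v : Vec (Fin (suc m)) (suc m)) → IsPermutation v → IsCyclic v →
                  i < suc m → j < suc m → orbit v i ≡ orbit v j → i ≡ j
orbit-injective {i = i} {j} v inj cyc i<n j<n e with <-cmp i j
... | tri< i<j _ _ = ⊥-elim (orbit-collision v inj cyc i<j j<n e)
... | tri≈ _ i≡j _ = i≡j
... | tri> _ _ j<i = ⊥-elim (orbit-collision v inj cyc j<i i<n (sym e))

contains⇒≤ : ∀ {m k} {w : Vec (Fin m) m} {σ : Vec (Fin k) k} → Contains w σ → k ≤ m
contains⇒≤ (idx , mono , _) = Finₚ.injective⇒≤ {f = idx} idx-injective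
  where
  idx-injective : Injective _≡_ _≡_ idx
  idx-injective {a} {b} e with Finₚ.<-cmp a b
  ... | tri< a<b _ _ = ⊥-elim (Finₚ.<-irrefl e (mono a b a<b))
  ... | tri≈ _ a≡b _ = a≡b
  ... | tri> _ _ b<a = ⊥-elim (Finₚ.<-irrefl (sym e) (mono b a b<a))

contains-by-order : ∀ {m k} (w : Vec (Fin m) m) (σ : Vec (Fin k) k) → IsPermutation σ →
                    (idx : Fin k → Fin m) → (∀ a b → a <ᶠ b → idx a <ᶠ idx b) →
                    (∀ a b → lookup σ a <ᶠ lookup σ b → lookup w (idx a) <ᶠ lookup w (idx b)) →
                    Contains w σ
contains-by-order w σ σ-injective idx mono preserves =
  idx , mono , λ a b → mk⇔ (reflects a b) (preserves a b)
  where
  reflects : ∀ a b → lookup w (idx a) <ᶠ lookup w (idx b) → lookup σ a <ᶠ lookup σ b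
  reflects a b lt with Finₚ.<-cmp (lookup σ a) (lookup σ b)
  ... | tri< σa<σb _ _ = σa<σb
  ... | tri≈ _ σa≡σb _ = ⊥-elim (Finₚ.<-irrefl (cong (lookup w ∘ idx) (σ-injective σa≡σb)) lt)
  ... | tri> _ _ σb<σa = ⊥-elim (Finₚ.<-asym lt (preserves b a σb<σa))

injective? : ∀ {k n} (f : Fin k → Fin n) → Dec (∀ a b → f a ≡ f b → a ≡ b)
injective? f = Finₚ.all? λ a → Finₚ.all? λ b → (f a Finₚ.≟ f b) →-dec (a Finₚ.≟ b)

isPermutation-by-decision : ∀ {k} (σ : Vec (Fin k) k) → True (injective? (lookup σ)) → IsPermutation σ
isPermutation-by-decision σ ok {a} {b} = toWitness ok a b

triple : ∀ {m} → Fin m → Fin m → Fin m → Fin 3 → Fin m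
triple i₀ i₁ i₂ = lookup (i₀ ∷ i₁ ∷ i₂ ∷ [])

triple-increasing : ∀ {m} {i₀ i₁ i₂ : Fin m} → i₀ <ᶠ i₁ → i₁ <ᶠ i₂ →
                    ∀ a b → a <ᶠ b → triple i₀ i₁ i₂ a <ᶠ triple i₀ i₁ i₂ b
triple-increasing i₀<i₁ i₁<i₂ zero             (suc zero)       _ = i₀<i₁
triple-increasing i₀<i₁ i₁<i₂ zero             (suc (suc zero)) _ = Finₚ.<-trans i₀<i₁ i₁<i₂
triple-increasing i₀<i₁ i₁<i₂ (suc zero)       (suc (suc zero)) _ = i₁<i₂
triple-increasing _     _     zero             zero             ()
triple-increasing _     _     (suc zero)       zero             ()
triple-increasing _     _     (suc zero)       (suc zero)       (s≤s ())
triple-increasing _     _     (suc (suc zero)) zero             ()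
triple-increasing _     _     (suc (suc zero)) (suc zero)       (s≤s ())
triple-increasing _     _     (suc (suc zero)) (suc (suc zero)) (s≤s (s≤s ()))

contains321 : ∀ {m} (w : Vec (Fin m) m) {i₀ i₁ i₂} → i₀ <ᶠ i₁ → i₁ <ᶠ i₂ →
              lookup w i₂ <ᶠ lookup w i₁ → lookup w i₁ <ᶠ lookup w i₀ → Contains w p321
contains321 w {i₀} {i₁} {i₂} i₀<i₁ i₁<i₂ w₂<w₁ w₁<w₀ =
  contains-by-order w p321 (isPermutation-by-decision p321 _) (triple i₀ i₁ i₂)
    (triple-increasing i₀<i₁ i₁<i₂) preserves
  where
  preserves : ∀ a b → lookup p321 a <ᶠ lookup p321 b →
              lookup w (triple i₀ i₁ i₂ a) <ᶠ lookup w (triple i₀ i₁ i₂ b)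
  preserves (suc zero)       zero             _ = w₁<w₀
  preserves (suc (suc zero)) zero             _ = Finₚ.<-trans w₂<w₁ w₁<w₀
  preserves (suc (suc zero)) (suc zero)       _ = w₂<w₁
  preserves zero             zero             (s≤s (s≤s ()))
  preserves zero             (suc zero)       (s≤s ())
  preserves zero             (suc (suc zero)) ()
  preserves (suc zero)       (suc zero)       (s≤s ())
  preserves (suc zero)       (suc (suc zero)) ()
  preserves (suc (suc zero)) (suc (suc zero)) ()

contains213 : ∀ {m} (w : Vec (Fin m) m) {i₀ i₁ i₂} → i₀ <ᶠ i₁ → i₁ <ᶠ i₂ →
              lookup w i₁ <ᶠ lookup w i₀ → lookup w i₀ <ᶠ lookup w i₂ → Contains w p213
contains213 w {i₀} {i₁} {i₂} i₀<i₁ i₁<i₂ w₁<w₀ w₀<w₂ =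
  contains-by-order w p213 (isPermutation-by-decision p213 _) (triple i₀ i₁ i₂)
    (triple-increasing i₀<i₁ i₁<i₂) preserves
  where
  preserves : ∀ a b → lookup p213 a <ᶠ lookup p213 b →
              lookup w (triple i₀ i₁ i₂ a) <ᶠ lookup w (triple i₀ i₁ i₂ b)
  preserves zero             (suc (suc zero)) _ = w₀<w₂
  preserves (suc zero)       zero             _ = w₁<w₀
  preserves (suc zero)       (suc (suc zero)) _ = Finₚ.<-trans w₁<w₀ w₀<w₂
  preserves zero             zero             (s≤s ())
  preserves zero             (suc zero)       ()
  preserves (suc zero)       (suc zero)       ()
  preserves (suc (suc zero)) zero             (s≤s ())
  preserves (suc (suc zero)) (suc zero)       ()
  preserves (suc (suc zero)) (suc (suc zero)) (s≤s (s≤s ()))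

<ᶠ-chain⇒2≤ : ∀ {m} {x y z : Fin m} → x <ᶠ y → y <ᶠ z → 2 ≤ toℕ z
<ᶠ-chain⇒2≤ x<y y<z = ≤-trans (s≤s (≤-trans (s≤s z≤n) x<y)) y<z

occurrence-at-0 : ∀ {m k} (w : Vec (Fin (suc m)) (suc m)) (σ : Vec (Fin (suc k)) (suc k))
                  (c : Contains w σ) a → proj₁ c (suc a) ≢ zero
occurrence-at-0 _ _ (idx , mono , _) a e = n≮0 (subst (λ i → idx zero <ᶠ i) e (mono zero (suc a) z<s))

occurrence-at-1 : ∀ {m k} (w : Vec (Fin (suc (suc m))) (suc (suc m)))
                  (σ : Vec (Fin (suc (suc k))) (suc (suc k)))
                  (c : Contains w σ) a → proj₁ c (suc (suc a)) ≢ suc zero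
occurrence-at-1 _ _ (idx , mono , _) a e = 1+n≰n (subst (λ i → 2 ≤ toℕ i) e idx₂≥2)
  where
  idx₂≥2 : 2 ≤ toℕ (idx (suc (suc a)))
  idx₂≥2 = <ᶠ-chain⇒2≤ (mono zero (suc zero) z<s) (mono (suc zero) (suc (suc a)) (s<s z<s))

occurrence-at-last : ∀ {m k} (w : Vec (Fin (suc m)) (suc m)) (σ : Vec (Fin k) k)
                     (c : Contains w σ) {a b} → a <ᶠ b → proj₁ c a ≢ fromℕ m
occurrence-at-last _ _ (idx , mono , _) {a} {b} a<b e =
  <⇒≱ (mono a b a<b) (subst (λ i → toℕ (idx b) ≤ toℕ i) (sym e) (Finₚ.≤fromℕ (idx b)))

occurrence-value-0 : ∀ {m k} (w : Vec (Fin (suc m)) (suc m)) (σ : Vec (Fin k) k)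
                     (c : Contains w σ) {a b} →
                     lookup σ b <ᶠ lookup σ a → lookup w (proj₁ c a) ≢ zero
occurrence-value-0 w _ (idx , _ , iff) {a} {b} σb<σa e =
  n≮0 (subst (λ y → lookup w (idx b) <ᶠ y) e (from (iff b a) σb<σa))

occurrence-value-1 : ∀ {m k} (w : Vec (Fin (suc (suc m))) (suc (suc m))) (σ : Vec (Fin k) k)
                     (c : Contains w σ) {a b d} → lookup σ b <ᶠ lookup σ a → lookup σ d <ᶠ lookup σ b →
                     lookup w (proj₁ c a) ≢ suc zero
occurrence-value-1 _ _ (idx , _ , iff) {a} {b} {d} σb<σa σd<σb e =
  1+n≰n (subst (λ y → 2 ≤ toℕ y) e (<ᶠ-chain⇒2≤ (from (iff d b) σd<σb) (from (iff b a) σb<σa)))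

punchIn-mono-< : ∀ {n} (i : Fin (suc n)) {x y : Fin n} → x <ᶠ y → punchIn i x <ᶠ punchIn i y
punchIn-mono-< i {x} {y} x<y = ≰⇒> (λ le → <⇒≱ x<y (punchIn-cancel-≤ i y x le))

punchIn-cancel-< : ∀ {n} (i : Fin (suc n)) {x y : Fin n} → punchIn i x <ᶠ punchIn i y → x <ᶠ y
punchIn-cancel-< i {x} {y} lt = ≰⇒> (λ le → <⇒≱ lt (punchIn-mono-≤ i y x le))

punchIn-view : ∀ {n} (r i : Fin (suc n)) → i ≡ r ⊎ ∃ λ x → i ≡ punchIn r x
punchIn-view r i with i Finₚ.≟ r
... | yes i≡r = inj₁ i≡r
... | no  i≢r = inj₂ (punchOut (i≢r ∘ sym) , sym (punchIn-punchOut (i≢r ∘ sym)))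

lookup-extensional : ∀ {A : Set} {n} {u u′ : Vec A n} → (∀ i → lookup u i ≡ lookup u′ i) → u ≡ u′
lookup-extensional {u = u} {u′} eq = begin
  u                    ≡⟨ sym (tabulate∘lookup u) ⟩
  tabulate (lookup u)  ≡⟨ tabulate-cong eq ⟩
  tabulate (lookup u′) ≡⟨ tabulate∘lookup u′ ⟩
  u′                   ∎
  where open ≡-Reasoning

record Extends {m} (r q : Fin (suc m)) (w : Vec (Fin (suc m)) (suc m)) (v : Vec (Fin m) m) : Set where
  constructor extends
  field lookup-punchIn : ∀ x → lookup w (punchIn r x) ≡ punchIn q (lookup v x)

Insertion : ∀ {m} → Fin (suc m) → Fin (suc m) → Vec (Fin (suc m)) (suc m) → Vec (Fin m) m → Set
Insertion r q w v = lookup w r ≡ q × Extends r q w v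

insertion-unique : ∀ {m} {r q : Fin (suc m)} {w w′ v} → Insertion r q w v → Insertion r q w′ v → w ≡ w′
insertion-unique {r = r} {w = w} {w′} (w-r , extends ext) (w′-r , extends ext′) =
  lookup-extensional pointwise
  where
  pointwise : ∀ i → lookup w i ≡ lookup w′ i
  pointwise i with punchIn-view r i
  ... | inj₁ refl       = trans w-r (sym w′-r)
  ... | inj₂ (x , refl) = trans (ext x) (sym (ext′ x))

extends-injective : ∀ {m} {r q : Fin (suc m)} {w w′ v v′} →
                    Extends r q w v → Extends r q w′ v′ → w ≡ w′ → v ≡ v′
extends-injective {q = q} (extends ext) (extends ext′) refl =
  lookup-extensional λ x → punchIn-injective q _ _ (trans (sym (ext x)) (ext′ x))

insertion-exists : ∀ {m} {r q : Fin (suc m)} {w} → IsPermutation w → lookup w r ≡ q →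
                   ∃ λ v → Insertion r q w v
insertion-exists {r = r} {q} {w} inj w-r = tabulate (λ x → punchOut (q≢ x)) , w-r , extends ext
  where
  q≢ : ∀ x → q ≢ lookup w (punchIn r x)
  q≢ x e = punchInᵢ≢i r x (sym (inj (trans w-r e)))
  ext : ∀ x → lookup w (punchIn r x) ≡ punchIn q (lookup (tabulate (λ x → punchOut (q≢ x))) x)
  ext x = trans (sym (punchIn-punchOut (q≢ x))) (cong (punchIn q) (sym (lookup∘tabulate _ x)))

isPermutation-delete : ∀ {m} {r q : Fin (suc m)} {w v} → Extends r q w v → IsPermutation w → IsPermutation v
isPermutation-delete {r = r} {q} (extends ext) inj {x} {y} e =
  punchIn-injective r _ _ (inj (trans (ext x) (trans (cong (punchIn q) e) (sym (ext y)))))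

isPermutation-insert : ∀ {m} {r q : Fin (suc m)} {w v} → Insertion r q w v → IsPermutation v → IsPermutation w
isPermutation-insert {r = r} {q} {v = v} (w-r , extends ext) inj {i} {j} e
  with punchIn-view r i | punchIn-view r j
... | inj₁ refl       | inj₁ refl       = refl
... | inj₁ refl       | inj₂ (y , refl) =
  ⊥-elim (punchInᵢ≢i q (lookup v y) (trans (sym (ext y)) (trans (sym e) w-r)))
... | inj₂ (x , refl) | inj₁ refl       =
  ⊥-elim (punchInᵢ≢i q (lookup v x) (trans (sym (ext x)) (trans e w-r)))
... | inj₂ (x , refl) | inj₂ (y , refl) =
  cong (punchIn r) (inj (punchIn-injective q _ _ (trans (sym (ext x)) (trans e (ext y)))))

contains-insert : ∀ {m k} {r q : Fin (suc m)} {w v} {σ : Vec (Fin k) k} →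
                  Extends r q w v → Contains v σ → Contains w σ
contains-insert {r = r} {q} {w} {v} (extends ext) (idx , mono , iff) =
  punchIn r ∘ idx , (λ a b a<b → punchIn-mono-< r (mono a b a<b)) , λ a b → mk⇔
    (λ lt → to (iff a b) (punchIn-cancel-< q (subst₂ _<ᶠ_ (ext (idx a)) (ext (idx b)) lt)))
    (λ lt → subst₂ _<ᶠ_ (sym (ext (idx a))) (sym (ext (idx b))) (punchIn-mono-< q (from (iff a b) lt)))

contains-delete : ∀ {m k} {r q : Fin (suc m)} {w v} {σ : Vec (Fin k) k} → Extends r q w v →
                  (c : Contains w σ) → (∀ a → proj₁ c a ≢ r) → Contains v σ
contains-delete {m} {k} {r} {q} {w} {v} {σ} (extends ext) (idx , mono , iff) avoids-r = idx′ , mono′ , iff′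
  where
  idx′ : Fin k → Fin m
  idx′ a = punchOut (avoids-r a ∘ sym)
  idx≡ : ∀ a → idx a ≡ punchIn r (idx′ a)
  idx≡ a = sym (punchIn-punchOut _)
  w≡ : ∀ a → lookup w (idx a) ≡ punchIn q (lookup v (idx′ a))
  w≡ a = trans (cong (lookup w) (idx≡ a)) (ext (idx′ a))
  mono′ : ∀ a b → a <ᶠ b → idx′ a <ᶠ idx′ b
  mono′ a b a<b = punchIn-cancel-< r (subst₂ _<ᶠ_ (idx≡ a) (idx≡ b) (mono a b a<b))
  iff′ : ∀ a b → (lookup v (idx′ a) <ᶠ lookup v (idx′ b)) ⇔ (lookup σ a <ᶠ lookup σ b)
  iff′ a b = mk⇔
    (λ lt → to (iff a b) (subst₂ _<ᶠ_ (sym (w≡ a)) (sym (w≡ b)) (punchIn-mono-< q lt)))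
    (λ lt → punchIn-cancel-< q (subst₂ _<ᶠ_ (w≡ a) (w≡ b) (from (iff a b) lt)))

punchIn₁≡suc : ∀ {n} {y : Fin (suc n)} → y ≢ zero → punchIn (suc zero) y ≡ suc y
punchIn₁≡suc {y = zero}  y≢0 = ⊥-elim (y≢0 refl)
punchIn₁≡suc {y = suc y} _   = refl

punchIn₁-cases : ∀ {n} (y : Fin (suc n)) → punchIn (suc zero) y ≡ zero ⊎ punchIn (suc zero) y ≡ suc y
punchIn₁-cases zero    = inj₁ refl
punchIn₁-cases (suc y) = inj₂ refl

suc-cases : ∀ {n} (y : Fin (suc n)) → suc y ≡ suc zero ⊎ suc y ≡ punchIn (suc zero) y
suc-cases zero    = inj₁ refl
suc-cases (suc y) = inj₂ refl

module Prepend {m} {w : Vec (Fin (suc (suc m))) (suc (suc m))} {v : Vec (Fin (suc m)) (suc m)}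
               (ins : Insertion zero (suc zero) w v) where

  private
    w₀≡1 : lookup w zero ≡ suc zero
    w₀≡1 = proj₁ ins
    ext : ∀ x → lookup w (suc x) ≡ punchIn (suc zero) (lookup v x)
    ext = Extends.lookup-punchIn (proj₂ ins)

  orbit-suc : IsCyclic v → ∀ i → i ≤ m → orbit w (suc i) ≡ suc (orbit v i)
  orbit-suc cyc i i≤m = begin
    orbit w (suc i)                    ≡⟨ iter-sucʳ (lookup w) i zero ⟩
    iter (lookup w) i (lookup w zero)  ≡⟨ cong (iter (lookup w) i) w₀≡1 ⟩
    iter (lookup w) i (suc zero)       ≡⟨ iter-intertwine {f = lookup w} {g = lookup v} {σ = suc} comm i
                                            (λ j 0<j j≤i → cyclic⇒orbit≢0 v cyc 0<j (≤-trans j≤i i≤m)) ⟩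
    suc (orbit v i)                    ∎
    where
    open ≡-Reasoning
    comm : ∀ x → lookup v x ≢ zero → lookup w (suc x) ≡ suc (lookup v x)
    comm x vx≢0 = trans (ext x) (punchIn₁≡suc vx≢0)

  cycleSeq-extends : IsCyclic v → Extends zero zero (cycleSeq w) (cycleSeq v)
  cycleSeq-extends cyc = extends λ x → begin
    lookup (cycleSeq w) (suc x)   ≡⟨ lookup-cycleSeq w (suc x) ⟩
    orbit w (suc (toℕ x))         ≡⟨ orbit-suc cyc (toℕ x) (≤-pred (toℕ<n x)) ⟩
    suc (orbit v (toℕ x))         ≡⟨ cong suc (sym (lookup-cycleSeq v x)) ⟩
    suc (lookup (cycleSeq v) x)   ∎
    where open ≡-Reasoning

  isCyclic-insert : IsPermutation v → IsCyclic v → IsCyclic w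
  isCyclic-insert inj cyc zero    = 0 , refl
  isCyclic-insert inj cyc (suc y) = reach (cyclic⇒reached-early v inj cyc y)
    where
    reach : (∃ λ r → r < suc m × orbit v r ≡ y) → ∃ λ k → orbit w k ≡ suc y
    reach (k , k<n , e) = suc k , trans (orbit-suc cyc k (≤-pred k<n)) (cong suc e)

  Visited : Fin (suc (suc m)) → Set
  Visited x = x ≡ zero ⊎ ∃ λ k → x ≡ suc (orbit v k)

  orbit-visited : ∀ k → Visited (orbit w k)
  orbit-visited k = iter-closed Visited step k (inj₁ refl)
    where
    step : ∀ {x} → Visited x → Visited (lookup w x)
    step (inj₁ refl) = inj₂ (0 , w₀≡1)
    step (inj₂ (k , refl)) =
      Sum.map (trans (ext (orbit v k))) (λ e → suc k , trans (ext (orbit v k)) e)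
              (punchIn₁-cases (orbit v (suc k)))

  isCyclic-delete : IsCyclic w → IsCyclic v
  isCyclic-delete cyc y = recover (orbit-visited (proj₁ (cyc (suc y)))) (proj₂ (cyc (suc y)))
    where
    recover : ∀ {x} → Visited x → x ≡ suc y → ∃ λ k → orbit v k ≡ y
    recover (inj₁ x≡0)       x≡1+y = ⊥-elim (Finₚ.0≢1+n (trans (sym x≡0) x≡1+y))
    recover (inj₂ (k , x≡)) x≡1+y = k , Finₚ.suc-injective (trans (sym x≡) x≡1+y)

  avoids-entry₀-321 : (c : Contains w p321) → ∀ a → proj₁ c a ≢ zero
  avoids-entry₀-321 c zero    e =
    occurrence-value-1 w p321 c {b = suc zero} {d = suc (suc zero)} (s<s z<s) z<s (trans (cong (lookup w) e) w₀≡1)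
  avoids-entry₀-321 c (suc a) = occurrence-at-0 w p321 c a

  avoids-entry₀-213 : (c : Contains (cycleSeq w) p213) → ∀ a → proj₁ c a ≢ zero
  avoids-entry₀-213 c zero    e =
    occurrence-value-0 (cycleSeq w) p213 c {b = suc zero} z<s (cong (lookup (cycleSeq w)) e)
  avoids-entry₀-213 c (suc a) = occurrence-at-0 (cycleSeq w) p213 c a

  membership : InA321-213 w ⇔ InA321-213 v
  membership = mk⇔ delete insert
    where
    delete : InA321-213 w → InA321-213 v
    delete (inj , cyc , av321 , av213) =
      isPermutation-delete (proj₂ ins) inj , cycᵥ ,
      av321 ∘ contains-insert {w = w} {v} {p321} (proj₂ ins) ,
      av213 ∘ contains-insert {w = cycleSeq w} {cycleSeq v} {p213} (cycleSeq-extends cycᵥ)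
      where
      cycᵥ : IsCyclic v
      cycᵥ = isCyclic-delete cyc
    insert : InA321-213 v → InA321-213 w
    insert (inj , cyc , av321 , av213) =
      isPermutation-insert ins inj , isCyclic-insert inj cyc ,
      (λ c → av321 (contains-delete {w = w} {v} {p321} (proj₂ ins) c (avoids-entry₀-321 c))) ,
      (λ c → av213 (contains-delete {w = cycleSeq w} {cycleSeq v} {p213} (cycleSeq-extends cyc) c
                                    (avoids-entry₀-213 c)))

toℕ-punchIn-fromℕ : ∀ {n} (x : Fin n) → toℕ (punchIn (fromℕ n) x) ≡ toℕ x
toℕ-punchIn-fromℕ zero    = refl
toℕ-punchIn-fromℕ (suc x) = cong suc (toℕ-punchIn-fromℕ x)

module Append {m} {w : Vec (Fin (suc (suc m))) (suc (suc m))} {v : Vec (Fin (suc m)) (suc m)}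
              (ins : Insertion (suc zero) zero w v) where

  private
    w₁≡0 : lookup w (suc zero) ≡ zero
    w₁≡0 = proj₁ ins
    ext : ∀ x → lookup w (punchIn (suc zero) x) ≡ suc (lookup v x)
    ext = Extends.lookup-punchIn (proj₂ ins)

  orbit-punchIn : IsCyclic v → ∀ i → i ≤ m → orbit w i ≡ punchIn (suc zero) (orbit v i)
  orbit-punchIn cyc i i≤m =
    iter-intertwine {f = lookup w} {g = lookup v} {σ = punchIn (suc zero)} comm i
      (λ j 0<j j≤i → cyclic⇒orbit≢0 v cyc 0<j (≤-trans j≤i i≤m))
    where
    comm : ∀ x → lookup v x ≢ zero → lookup w (punchIn (suc zero) x) ≡ punchIn (suc zero) (lookup v x)
    comm x vx≢0 = trans (ext x) (sym (punchIn₁≡suc vx≢0))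

  orbit-last : IsPermutation v → IsCyclic v → orbit w (suc m) ≡ suc zero
  orbit-last inj cyc = begin
    lookup w (orbit w m)                      ≡⟨ cong (lookup w) (orbit-punchIn cyc m ≤-refl) ⟩
    lookup w (punchIn (suc zero) (orbit v m)) ≡⟨ ext (orbit v m) ⟩
    suc (orbit v (suc m))                     ≡⟨ cong suc (orbit-return v inj cyc) ⟩
    suc zero                                  ∎
    where open ≡-Reasoning

  cycleSeq-extends : IsCyclic v → Extends (fromℕ (suc m)) (suc zero) (cycleSeq w) (cycleSeq v)
  cycleSeq-extends cyc = extends λ x → begin
    lookup (cycleSeq w) (punchIn (fromℕ (suc m)) x) ≡⟨ lookup-cycleSeq w (punchIn (fromℕ (suc m)) x) ⟩
    orbit w (toℕ (punchIn (fromℕ (suc m)) x))       ≡⟨ cong (orbit w) (toℕ-punchIn-fromℕ x) ⟩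
    orbit w (toℕ x)                                 ≡⟨ orbit-punchIn cyc (toℕ x) (≤-pred (toℕ<n x)) ⟩
    punchIn (suc zero) (orbit v (toℕ x))            ≡⟨ cong (punchIn (suc zero)) (sym (lookup-cycleSeq v x)) ⟩
    punchIn (suc zero) (lookup (cycleSeq v) x)      ∎
    where open ≡-Reasoning

  isCyclic-insert : IsPermutation v → IsCyclic v → IsCyclic w
  isCyclic-insert inj cyc y = reach (punchIn-view (suc zero) y)
    where
    lift : ∀ {x} → (∃ λ r → r < suc m × orbit v r ≡ x) → ∃ λ k → orbit w k ≡ punchIn (suc zero) x
    lift (k , k<n , e) = k , trans (orbit-punchIn cyc k (≤-pred k<n)) (cong (punchIn (suc zero)) e)
    reach : (y ≡ suc zero ⊎ ∃ λ x → y ≡ punchIn (suc zero) x) → ∃ λ k → orbit w k ≡ y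
    reach (inj₁ refl)       = suc m , orbit-last inj cyc
    reach (inj₂ (x , refl)) = lift (cyclic⇒reached-early v inj cyc x)

  Visited : Fin (suc (suc m)) → Set
  Visited x = x ≡ suc zero ⊎ ∃ λ k → x ≡ punchIn (suc zero) (orbit v k)

  orbit-visited : ∀ k → Visited (orbit w k)
  orbit-visited k = iter-closed Visited step k (inj₂ (0 , refl))
    where
    step : ∀ {x} → Visited x → Visited (lookup w x)
    step (inj₁ refl) = inj₂ (0 , w₁≡0)
    step (inj₂ (k , refl)) =
      Sum.map (trans (ext (orbit v k))) (λ e → suc k , trans (ext (orbit v k)) e)
              (suc-cases (orbit v (suc k)))

  isCyclic-delete : IsCyclic w → IsCyclic v
  isCyclic-delete cyc y = recover (orbit-visited (proj₁ (cyc y′))) (proj₂ (cyc y′))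
    where
    y′ : Fin (suc (suc m))
    y′ = punchIn (suc zero) y
    recover : ∀ {x} → Visited x → x ≡ y′ → ∃ λ k → orbit v k ≡ y
    recover (inj₁ x≡1)       x≡y′ = ⊥-elim (punchInᵢ≢i (suc zero) y (trans (sym x≡y′) x≡1))
    recover (inj₂ (k , x≡)) x≡y′ = k , punchIn-injective (suc zero) _ _ (trans (sym x≡) x≡y′)

  avoids-entry₁-321 : (c : Contains w p321) → ∀ a → proj₁ c a ≢ suc zero
  avoids-entry₁-321 c zero             e =
    occurrence-value-0 w p321 c {b = suc zero} (s<s z<s) (trans (cong (lookup w) e) w₁≡0)
  avoids-entry₁-321 c (suc zero)       e =
    occurrence-value-0 w p321 c {b = suc (suc zero)} z<s (trans (cong (lookup w) e) w₁≡0)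
  avoids-entry₁-321 c (suc (suc zero)) = occurrence-at-1 w p321 c zero

  avoids-last-213 : IsPermutation v → IsCyclic v → (c : Contains (cycleSeq w) p213) →
                    ∀ a → proj₁ c a ≢ fromℕ (suc m)
  avoids-last-213 inj cyc c zero             = occurrence-at-last (cycleSeq w) p213 c {b = suc (suc zero)} z<s
  avoids-last-213 inj cyc c (suc zero)       = occurrence-at-last (cycleSeq w) p213 c {b = suc (suc zero)} (s<s z<s)
  avoids-last-213 inj cyc c (suc (suc zero)) e =
    occurrence-value-1 (cycleSeq w) p213 c {b = zero} {d = suc zero} (s<s z<s) z<s (begin
      lookup (cycleSeq w) (proj₁ c (suc (suc zero))) ≡⟨ cong (lookup (cycleSeq w)) e ⟩
      lookup (cycleSeq w) (fromℕ (suc m))             ≡⟨ lookup-cycleSeq w (fromℕ (suc m)) ⟩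
      orbit w (toℕ (fromℕ (suc m)))                   ≡⟨ cong (orbit w) (Finₚ.toℕ-fromℕ (suc m)) ⟩
      orbit w (suc m)                                 ≡⟨ orbit-last inj cyc ⟩
      suc zero                                        ∎)
    where open ≡-Reasoning

  membership : InA321-213 w ⇔ InA321-213 v
  membership = mk⇔ delete insert
    where
    delete : InA321-213 w → InA321-213 v
    delete (inj , cyc , av321 , av213) =
      isPermutation-delete (proj₂ ins) inj , cycᵥ ,
      av321 ∘ contains-insert {w = w} {v} {p321} (proj₂ ins) ,
      av213 ∘ contains-insert {w = cycleSeq w} {cycleSeq v} {p213} (cycleSeq-extends cycᵥ)
      where
      cycᵥ : IsCyclic v
      cycᵥ = isCyclic-delete cyc
    insert : InA321-213 v → InA321-213 w
    insert (inj , cyc , av321 , av213) =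
      isPermutation-insert ins inj , isCyclic-insert inj cyc ,
      (λ c → av321 (contains-delete {w = w} {v} {p321} (proj₂ ins) c (avoids-entry₁-321 c))) ,
      (λ c → av213 (contains-delete {w = cycleSeq w} {cycleSeq v} {p213} (cycleSeq-extends cyc) c
                                    (avoids-last-213 inj cyc c)))

2≤toℕ : ∀ {n} {y : Fin (suc (suc n))} → y ≢ zero → y ≢ suc zero → 2 ≤ toℕ y
2≤toℕ {y = zero}          y≢0 _   = ⊥-elim (y≢0 refl)
2≤toℕ {y = suc zero}      _   y≢1 = ⊥-elim (y≢1 refl)
2≤toℕ {y = suc (suc y)}   _   _   = s≤s (s≤s z≤n)

lookup-cycleSeq-fromℕ< : ∀ {m i} (w : Vec (Fin (suc m)) (suc m)) (i<n : i < suc m) →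
                         lookup (cycleSeq w) (fromℕ< i<n) ≡ orbit w i
lookup-cycleSeq-fromℕ< w i<n = trans (lookup-cycleSeq w (fromℕ< i<n)) (cong (orbit w) (toℕ-fromℕ< i<n))

cycleSeq-contains213 : ∀ {m i j l} (w : Vec (Fin (suc m)) (suc m)) → i < j → j < l → l < suc m →
                       orbit w j <ᶠ orbit w i → orbit w i <ᶠ orbit w l → Contains (cycleSeq w) p213
cycleSeq-contains213 {m} {i} {j} w i<j j<l l<n wj<wi wi<wl =
  contains213 (cycleSeq w) (position i<n j<n i<j) (position j<n l<n j<l)
              (value j<n i<n wj<wi) (value i<n l<n wi<wl)
  where
  j<n : j < suc m
  j<n = <-trans j<l l<n
  i<n : i < suc m
  i<n = <-trans i<j j<n
  position : ∀ {s t} (s<n : s < suc m) (t<n : t < suc m) → s < t → fromℕ< s<n <ᶠ fromℕ< t<n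
  position s<n t<n = subst₂ _<_ (sym (toℕ-fromℕ< s<n)) (sym (toℕ-fromℕ< t<n))
  value : ∀ {s t} (s<n : s < suc m) (t<n : t < suc m) → orbit w s <ᶠ orbit w t →
          lookup (cycleSeq w) (fromℕ< s<n) <ᶠ lookup (cycleSeq w) (fromℕ< t<n)
  value s<n t<n = subst₂ _<ᶠ_ (sym (lookup-cycleSeq-fromℕ< w s<n)) (sym (lookup-cycleSeq-fromℕ< w t<n))

interior-one⇒pattern : ∀ {k r} (w : Vec (Fin (3 + k)) (3 + k)) → IsPermutation w → IsCyclic w →
                       r < k → orbit w (2 + r) ≡ suc zero →
                       Contains w p321 ⊎ Contains (cycleSeq w) p213
interior-one⇒pattern {k} {r} w inj cyc r<k w¹ = compare (Finₚ.<-cmp a b)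
  where
  a b x : Fin (3 + k)
  a = lookup w zero
  b = lookup w (suc zero)
  x = orbit w (1 + r)
  2+r<N : 2 + r < 3 + k
  2+r<N = s<s (s<s (s≤s (<⇒≤ r<k)))
  3+r<N : 3 + r < 3 + k
  3+r<N = s<s (s<s (s<s r<k))
  1≢3+r : 1 ≢ 3 + r
  1≢3+r ()
  orbit-3+r : orbit w (3 + r) ≡ b
  orbit-3+r = cong (lookup w) w¹
  orbit-≥2 : ∀ {i} → i < 3 + k → i ≢ 0 → i ≢ 2 + r → 2 ≤ toℕ (orbit w i)
  orbit-≥2 i<N i≢0 i≢2+r =
    2≤toℕ (i≢0 ∘ orbit-injective w inj cyc i<N z<s)
          (i≢2+r ∘ orbit-injective w inj cyc i<N 2+r<N ∘ (λ e → trans e (sym w¹)))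
  a≥2 : 2 ≤ toℕ a
  a≥2 = orbit-≥2 (s<s z<s) (λ ()) (λ ())
  b≥2 : 2 ≤ toℕ b
  b≥2 = subst (λ y → 2 ≤ toℕ y) orbit-3+r (orbit-≥2 3+r<N (λ ()) 1+n≢n)
  x≥2 : 2 ≤ toℕ x
  x≥2 = orbit-≥2 (<-trans (n<1+n _) 2+r<N) (λ ()) (1+n≢n ∘ sym)
  compare : Tri (a <ᶠ b) (a ≡ b) (b <ᶠ a) → Contains w p321 ⊎ Contains (cycleSeq w) p213
  compare (tri< a<b _ _) = inj₂ (cycleSeq-contains213 w (s<s z<s) (n<1+n _) 3+r<N
    (subst (_<ᶠ a) (sym w¹) a≥2) (subst (a <ᶠ_) (sym orbit-3+r) a<b))
  compare (tri≈ _ a≡b _) =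
    ⊥-elim (1≢3+r (orbit-injective w inj cyc (s<s z<s) 3+r<N (trans a≡b (sym orbit-3+r))))
  compare (tri> _ _ b<a) = inj₁ (contains321 w {i₂ = x} z<s x≥2 (subst (_<ᶠ b) (sym w¹) b≥2) b<a)

lookup₀≡1⊎lookup₁≡0 : ∀ {k} (w : Vec (Fin (3 + k)) (3 + k)) → InA321-213 w →
                      lookup w zero ≡ suc zero ⊎ lookup w (suc zero) ≡ zero
lookup₀≡1⊎lookup₁≡0 {k} w (inj , cyc , av321 , av213) =
  position-of-1 (cyclic⇒reached-early w inj cyc (suc zero))
  where
  position-of-1 : (∃ λ r → r < 3 + k × orbit w r ≡ suc zero) →
                  lookup w zero ≡ suc zero ⊎ lookup w (suc zero) ≡ zero
  position-of-1 (zero , _ , ())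
  position-of-1 (suc zero , _ , e) = inj₁ e
  position-of-1 (suc (suc r) , 2+r<N , e) =
    interior-or-last (m≤n⇒m<n∨m≡n (≤-pred (≤-pred (≤-pred 2+r<N))))
    where
    interior-or-last : r < k ⊎ r ≡ k → lookup w zero ≡ suc zero ⊎ lookup w (suc zero) ≡ zero
    interior-or-last (inj₁ r<k) = ⊥-elim ([ av321 , av213 ] (interior-one⇒pattern w inj cyc r<k e))
    interior-or-last (inj₂ refl) = inj₂ (trans (sym (cong (lookup w) e)) (orbit-return w inj cyc))

-- In cycle notation, prependToCycle v is 0 followed by the cycle of v shifted up,
-- and appendToCycle v is the cycle of v with 1 punched in, followed by 1.
prependToCycle : ∀ {m} → Vec (Fin (suc m)) (suc m) → Vec (Fin (suc (suc m))) (suc (suc m))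
prependToCycle v = suc zero ∷ map (punchIn (suc zero)) v

appendToCycle : ∀ {m} → Vec (Fin (suc m)) (suc m) → Vec (Fin (suc (suc m))) (suc (suc m))
appendToCycle (x ∷ xs) = suc x ∷ zero ∷ map suc xs

prependToCycle-insertion : ∀ {m} (v : Vec (Fin (suc m)) (suc m)) →
                           Insertion zero (suc zero) (prependToCycle v) v
prependToCycle-insertion v = refl , extends λ x → lookup-map x (punchIn (suc zero)) v

appendToCycle-insertion : ∀ {m} (v : Vec (Fin (suc m)) (suc m)) →
                          Insertion (suc zero) zero (appendToCycle v) v
appendToCycle-insertion (x ∷ xs) = refl , extends λ { zero → refl ; (suc i) → lookup-map i suc xs }

prependToCycle-injective : ∀ {m} → Injective _≡_ _≡_ (prependToCycle {m})
prependToCycle-injective =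
  extends-injective (proj₂ (prependToCycle-insertion _)) (proj₂ (prependToCycle-insertion _))

appendToCycle-injective : ∀ {m} → Injective _≡_ _≡_ (appendToCycle {m})
appendToCycle-injective =
  extends-injective (proj₂ (appendToCycle-insertion _)) (proj₂ (appendToCycle-insertion _))

prependToCycle≢appendToCycle : ∀ {m} (v u : Vec (Fin (suc (suc m))) (suc (suc m))) → IsCyclic u →
                               prependToCycle v ≢ appendToCycle u
prependToCycle≢appendToCycle v (x ∷ xs) cyc e =
  cyclic⇒lookup0≢0 (x ∷ xs) cyc (sym (Finₚ.suc-injective (cong (λ w → lookup w zero) e)))

prependToCycle-or-appendToCycle : ∀ {k} (w : Vec (Fin (3 + k)) (3 + k)) → InA321-213 w →
                                  (∃ λ v → InA321-213 v × w ≡ prependToCycle v) ⊎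
                                  (∃ λ v → InA321-213 v × w ≡ appendToCycle v)
prependToCycle-or-appendToCycle w w∈A = Sum.map undo-prepend undo-append (lookup₀≡1⊎lookup₁≡0 w w∈A)
  where
  undo-prepend : lookup w zero ≡ suc zero → ∃ λ v → InA321-213 v × w ≡ prependToCycle v
  undo-prepend w₀≡1 = let v , ins = insertion-exists (proj₁ w∈A) w₀≡1 in
    v , to (Prepend.membership ins) w∈A , insertion-unique ins (prependToCycle-insertion v)
  undo-append : lookup w (suc zero) ≡ zero → ∃ λ v → InA321-213 v × w ≡ appendToCycle v
  undo-append w₁≡0 = let v , ins = insertion-exists (proj₁ w∈A) w₁≡0 in
    v , to (Append.membership ins) w∈A , insertion-unique ins (appendToCycle-insertion v)

Enumerates : ∀ {A : Set} → List A → (A → Set) → Set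
Enumerates L P = Unique L × (∀ x → (x ∈ L) ⇔ P x)

enumerates-++-map : ∀ {A B : Set} {L : List A} {P : A → Set} {Q : B → Set} {f g : A → B} →
                    Enumerates L P → Injective _≡_ _≡_ f → Injective _≡_ _≡_ g →
                    (∀ {x y} → P y → f x ≢ g y) →
                    (∀ x → P x → Q (f x)) → (∀ x → P x → Q (g x)) →
                    (∀ y → Q y → (∃ λ x → P x × y ≡ f x) ⊎ (∃ λ x → P x × y ≡ g x)) →
                    Enumerates (mapₗ f L ++ mapₗ g L) Q
enumerates-++-map {L = L} {P} {Q} {f} {g} (unique , mem) f-injective g-injective f≢g Qf Qg cover =
  Unique.++⁺ (Unique.map⁺ f-injective unique) (Unique.map⁺ g-injective unique) disjoint ,
  λ y → mk⇔ (sound y) (complete y)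
  where
  disjoint : ∀ {y} → ¬ (y ∈ mapₗ f L × y ∈ mapₗ g L)
  disjoint (y∈fL , y∈gL) with ∈-map⁻ f y∈fL | ∈-map⁻ g y∈gL
  ... | x , _ , refl | x′ , x′∈L , fx≡gx′ = f≢g (to (mem x′) x′∈L) fx≡gx′
  image : ∀ h → (∀ x → P x → Q (h x)) → ∀ {y} → y ∈ mapₗ h L → Q y
  image h Qh y∈hL with ∈-map⁻ h y∈hL
  ... | x , x∈L , refl = Qh x (to (mem x) x∈L)
  sound : ∀ y → y ∈ mapₗ f L ++ mapₗ g L → Q y
  sound y y∈ = [ image f Qf , image g Qg ] (∈-++⁻ (mapₗ f L) y∈)
  complete : ∀ y → Q y → y ∈ mapₗ f L ++ mapₗ g L
  complete y Qy with cover y Qy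
  ... | inj₁ (x , Px , refl) = ∈-++⁺ˡ (∈-map⁺ f (from (mem x) Px))
  ... | inj₂ (x , Px , refl) = ∈-++⁺ʳ (mapₗ f L) (∈-map⁺ g (from (mem x) Px))

length-++-map : ∀ {A B : Set} (f g : A → B) (L : List A) → length (mapₗ f L ++ mapₗ g L) ≡ 2 * length L
length-++-map f g L = begin
  length (mapₗ f L ++ mapₗ g L)           ≡⟨ length-++ (mapₗ f L) ⟩
  length (mapₗ f L) + length (mapₗ g L)   ≡⟨ cong₂ _+_ (length-map f L) (length-map g L) ⟩
  length L + length L                     ≡⟨ cong (length L +_) (sym (+-identityʳ (length L))) ⟩
  2 * length L                            ∎
  where open ≡-Reasoning

cycle₂ : Vec (Fin 2) 2
cycle₂ = suc zero ∷ zero ∷ []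

cycle₂∈A : InA321-213 cycle₂
cycle₂∈A =
  isPermutation-by-decision cycle₂ _ , reach , too-short cycle₂ p321 , too-short (cycleSeq cycle₂) p213
  where
  reach : IsCyclic cycle₂
  reach zero       = 0 , refl
  reach (suc zero) = 1 , refl
  too-short : ∀ (w : Vec (Fin 2) 2) (σ : Vec (Fin 3) 3) → ¬ Contains w σ
  too-short w σ c = 1+n≰n (contains⇒≤ {w = w} {σ} c)

A₂≡[cycle₂] : ∀ (w : Vec (Fin 2) 2) → InA321-213 w → w ≡ cycle₂
A₂≡[cycle₂] (zero ∷ x ∷ [])            (_ , cyc , _) =
  ⊥-elim (cyclic⇒lookup0≢0 (zero ∷ x ∷ []) cyc refl)
A₂≡[cycle₂] (suc zero ∷ zero ∷ [])     _             = refl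
A₂≡[cycle₂] (suc zero ∷ suc zero ∷ []) (inj , _)     =
  ⊥-elim (Finₚ.0≢1+n (inj {zero} {suc zero} refl))

enumeration : ∀ k → ∃ λ (L : List (Vec (Fin (2 + k)) (2 + k))) →
                       Enumerates L InA321-213 × length L ≡ 2 ^ k
enumeration zero =
  cycle₂ ∷ [] , ([] ∷ [] , λ w → mk⇔ (λ { (here refl) → cycle₂∈A }) (here ∘ A₂≡[cycle₂] w)) , refl
enumeration (suc k) =
  let L , enum , |L| = enumeration k in
  mapₗ prependToCycle L ++ mapₗ appendToCycle L ,
  enumerates-++-map enum
    prependToCycle-injective appendToCycle-injective
    (λ {v} {u} u∈A → prependToCycle≢appendToCycle v u (proj₁ (proj₂ u∈A)))
    (λ v → from (Prepend.membership (prependToCycle-insertion v)))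
    (λ v → from (Append.membership (appendToCycle-insertion v)))
    prependToCycle-or-appendToCycle ,
  trans (length-++-map prependToCycle appendToCycle L) (cong (2 *_) |L|)

theorem3p24 : (n : ℕ) → 2 ≤ suc n →
    ∃ λ (L : List (Vec (Fin (suc n)) (suc n))) →
      Unique L × (∀ v → (v ∈ L) ⇔ InA321-213 v) × (length L ≡ 2 ^ (suc n ∸ 2))
theorem3p24 zero    (s≤s ())
theorem3p24 (suc k) _ = let L , (unique , mem) , |L| = enumeration k in L , unique , mem , |L|
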